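{- Let $\mathcal{B}$ be the collection of bases of a symplectic matroid $M$ on $E_{\pm n}$, and let $\mathcal{C}$ be its collection of circuits (the minimal admissible subsets of $E_{\pm n}$ not contained in any member of $\mathcal{B}$). Let $C_1, C_2\in\mathcal{C}$ be distinct, with $C_1\cup C_2$ admissible, and let $x\in C_1\cap C_2$. Then for every $c\in C_1\,\Delta\, C_2$ there exists some $C_c\in\mathcal{C}$ such that $c\in C_c\subseteq (C_1\cup C_2)-\{x\}$.
   Context: $A\,\Delta\,B=(A\cup B)-(A\cap B)$. Let $E_{\pm n}=[n]\cup[n]^*$ where $[n]^*=\{1^*,\dots,n^*\}$ and $*$ is the involution $i\leftrightarrow i^*$; $S^*=\{s^*:s\in S\}$. A set $S$ is admissible if $S\cap S^*=\emptyset$. A linear ordering $<$ on $E_{\pm n}$ is admissible if $i<j$ implies $j^*<i^*$. For admissible $k$-sets $A=\{a_1<\dots<a_k\}$, $B=\{b_1<\dots<b_k\}$ set $A\le B$ iff $a_i\le b_i$ for all $i$. A symplectic matroid is a pair $(E_{\pm n};\mathcal{B})$ with $\mathcal{B}$ a non-empty family of equi-numerous admissible subsets of $E_{\pm n}$ such that for every admissible ordering, $\mathcal{B}$ has a unique maximal element in the induced order; members of $\mathcal{B}$ are bases. -}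

module Defs where

open import Data.Nat using (ℕ; _+_; _≤_; _<_)
open import Data.Nat.Properties using (≤-decTotalOrder)
open import Data.Bool using (Bool; true; false; not)
open import Data.Fin using (Fin)
open import Data.Fin.Subset as Sub using (Subset; ∣_∣)
open import Data.Fin.Subset.Properties using (_∈?_)
open import Data.List using (List; map; filter; allFin; concatMap; _∷_; [])
open import Data.List.Relation.Binary.Pointwise using (Pointwise)
open import Data.Product using (_×_; _,_; Σ; ∃; proj₁; proj₂)
open import Relation.Nullary using (¬_)
open import Relation.Binary.PropositionalEquality using (_≡_; _≢_)
import Data.List.Sort

-- Ground set E_{±n}: (i , false) is i, (i , true) is i*.

E : ℕ → Set
E n = Fin n × Bool

_* : ∀ {n} → E n → E n
(i , b) * = (i , not b)

-- subsets of E_{±n}: (unstarred part , starred part)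
SubE : ℕ → Set
SubE n = Subset n × Subset n

_∈ₑ_ : ∀ {n} → E n → SubE n → Set
(i , false) ∈ₑ (P , Q) = i Sub.∈ P
(i , true)  ∈ₑ (P , Q) = i Sub.∈ Q

_⊆ₑ_ : ∀ {n} → SubE n → SubE n → Set
S ⊆ₑ T = ∀ {e} → e ∈ₑ S → e ∈ₑ T

_∪ₑ_ : ∀ {n} → SubE n → SubE n → SubE n
(P , Q) ∪ₑ (P' , Q') = (P Sub.∪ P' , Q Sub.∪ Q')

_∩ₑ_ : ∀ {n} → SubE n → SubE n → SubE n
(P , Q) ∩ₑ (P' , Q') = (P Sub.∩ P' , Q Sub.∩ Q')

_─ₑ_ : ∀ {n} → SubE n → SubE n → SubE n
(P , Q) ─ₑ (P' , Q') = (P Sub.─ P' , Q Sub.─ Q')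

_Δₑ_ : ∀ {n} → SubE n → SubE n → SubE n
A Δₑ B = (A ∪ₑ B) ─ₑ (A ∩ₑ B)

∅ₑ : ∀ {n} → SubE n
∅ₑ = (Sub.⊥ , Sub.⊥)

⁅_⁆ₑ : ∀ {n} → E n → SubE n
⁅ i , false ⁆ₑ = (Sub.⁅ i ⁆ , Sub.⊥)
⁅ i , true  ⁆ₑ = (Sub.⊥ , Sub.⁅ i ⁆)

star : ∀ {n} → SubE n → SubE n
star (P , Q) = (Q , P)

∣_∣ₑ : ∀ {n} → SubE n → ℕ
∣ P , Q ∣ₑ = ∣ P ∣ + ∣ Q ∣

Admissible : ∀ {n} → SubE n → Set
Admissible S = S ∩ₑ star S ≡ ∅ₑ

-- Linear orderings of E_{±n}, given by an injective rank function
-- into ℕ:  e < e'  iff  rank e < rank e'.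

record LinOrd (n : ℕ) : Set where
  field
    rank  : E n → ℕ
    injective : ∀ {e e'} → rank e ≡ rank e' → e ≡ e'

open LinOrd public

AdmissibleOrd : ∀ {n} → LinOrd n → Set
AdmissibleOrd {n} O = ∀ (i j : E n) → rank O i < rank O j → rank O (j *) < rank O (i *)

allE : ∀ n → List (E n)
allE n = concatMap (λ i → (i , false) ∷ (i , true) ∷ []) (allFin n)

∈ₑ? : ∀ {n} (S : SubE n) (e : E n) → Relation.Nullary.Dec (e ∈ₑ S)
∈ₑ? (P , Q) (i , false) = i ∈? P
∈ₑ? (P , Q) (i , true)  = i ∈? Q

open Data.List.Sort ≤-decTotalOrder using (sort)

sortedRanks : ∀ {n} → LinOrd n → SubE n → List ℕ
sortedRanks O A = sort (map (rank O) (filter (∈ₑ? A) (allE _)))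

_≤[_]_ : ∀ {n} → SubE n → LinOrd n → SubE n → Set
A ≤[ O ] B = Pointwise _≤_ (sortedRanks O A) (sortedRanks O B)

IsMaximal : ∀ {n} → (SubE n → Set) → LinOrd n → SubE n → Set
IsMaximal 𝓑 O B₀ = 𝓑 B₀ × (∀ B → 𝓑 B → B₀ ≤[ O ] B → B ≡ B₀)

record IsSymplecticMatroid (n : ℕ) (𝓑 : SubE n → Set) : Set₁ where
  field
    nonempty     : Σ (SubE n) 𝓑
    admissible   : ∀ B → 𝓑 B → Admissible B
    equinumerous : ∀ B B' → 𝓑 B → 𝓑 B' → ∣ B ∣ₑ ≡ ∣ B' ∣ₑ
    uniqueMax    : ∀ (O : LinOrd n) → AdmissibleOrd O →
                   Σ (SubE n) (λ B₀ → IsMaximal 𝓑 O B₀ ×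
                     (∀ B₁ → IsMaximal 𝓑 O B₁ → B₁ ≡ B₀))

Dependent : ∀ {n} → (SubE n → Set) → SubE n → Set
Dependent 𝓑 C = Admissible C × (∀ B → 𝓑 B → ¬ (C ⊆ₑ B))

IsCircuit : ∀ {n} → (SubE n → Set) → SubE n → Set
IsCircuit 𝓑 C = Dependent 𝓑 C × (∀ D → Dependent 𝓑 D → D ⊆ₑ C → D ≡ C)

module Submission where

-- The axioms are used only through the Gale order: for each admissible
-- ordering O the bases have a unique Gale-maximal element B₀.  A unique
-- maximal element of a finite preorder is its maximum (UniqueMaximum), and
-- the number of points of a basis in an upper set of O is monotone in the
-- Gale order (GaleOrder), so B₀ meets every upper set of O maximally.  For
-- admissible I ⊆ S an explicit admissible ordering has both I and S as upper
-- sets (WeightedOrder, Levels), hence a single basis meets I and S maximally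
-- at once: the greedy property (SymplecticMatroid.greedy).
--
-- The greedy property gives: independence of admissible sets is decidable,
-- every dependent set contains a circuit, and deleting a point of a circuit
-- inside W does not lower the largest intersection of a basis with W.
-- Applying the last fact to c ∈ C₁ - C₂ and then to x ∈ C₂ shows that
-- (Bᵣ ∩ Rest) ∪ {c} is dependent, where Rest = (C₁ ∪ C₂) - {c, x} and Bᵣ is a
-- basis meeting Rest maximally; every circuit inside it contains c and
-- avoids x (strong-elimination), which is the theorem.

open import Defs
open import Data.Nat using (ℕ; zero; suc; _+_; _*_; _∸_; _≤_; _<_; _≤?_; z≤n; s≤s; _%_)
open import Data.Nat.Properties
  using ( ≤-refl; ≤-trans; ≤-reflexive; <-≤-trans; <-irrefl; ≤-decTotalOrder
        ; ≤-pred; ≰⇒>; <⇒≤; m≤n⇒m≤1+n; m≤m+n; m≤n+m; m≤n⇒m<n∨m≡n; m+[n∸m]≡n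
        ; +-mono-≤; +-monoˡ-≤; +-monoʳ-≤; +-mono-<-≤; +-monoˡ-<; +-monoʳ-<; +-suc
        ; +-identityʳ; +-assoc; +-comm; +-cancelˡ-≡; *-monoˡ-≤; ≤-antisym; <⇒≱; <⇒≢; ≮⇒≥; module ≤-Reasoning )
open import Data.Nat.DivMod using ([m+kn]%n≡m%n; m<n⇒m%n≡m)
open import Data.Nat.Induction using (<-wellFounded)
open import Data.Nat.ListAction using (sum)
open import Data.Nat.ListAction.Properties using (sum-↭)
open import Data.Nat.Solver using (module +-*-Solver)
open import Data.Bool using (true; false; not; if_then_else_)
open import Data.Bool.Properties using (not-involutive) renaming (_≟_ to _≟ᵇ_)
open import Data.Fin as Fin using (Fin; toℕ; opposite)
open import Data.Fin.Properties using (toℕ<n; toℕ-injective; opposite-prop; opposite-involutive)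
open import Data.Fin.Subset as Sub using (Subset; inside; outside)
open import Data.Fin.Subset.Properties
  using (_⊆?_; x∈p∪q⁻; x∈p∪q⁺; x∈p∩q⁻; x∈p∩q⁺; x∈⁅x⁆; x∈⁅y⁆⇒x≡y; ∉⊥; ⊆-antisym)
open import Data.Vec as Vec using ([]; _∷_)
open import Data.Vec.Properties as VecP using ()
open import Data.List using (List; []; _∷_; map; filter)
open import Data.List.Membership.Propositional using (_∈_)
open import Data.List.Membership.Propositional.Properties
  using (∈-allFin; ∈-concatMap⁺; ∈-map⁺; ∈-map⁻; ∈-filter⁺; ∈-filter⁻)
open import Data.List.Relation.Unary.Any as Any using (here; there; any?)
open import Data.List.Relation.Binary.Pointwise as Pointwise using (Pointwise; []; _∷_)
open import Data.List.Relation.Binary.Permutation.Propositional using (_↭_; prep; swap; ↭-sym; ↭-trans)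
import Data.List.Relation.Binary.Permutation.Propositional as Perm
open import Data.List.Relation.Binary.Permutation.Propositional.Properties using (∈-resp-↭)
open import Data.List.Sort ≤-decTotalOrder using (sort-↭)
open import Data.Product using (Σ; _×_; _,_; proj₁; proj₂; uncurry)
open import Data.Product.Properties using (≡-dec)
open import Data.Sum using (_⊎_; inj₁; inj₂; [_,_]′)
open import Data.Empty using (⊥-elim)
open import Function using (_∘_; flip)
open import Induction.WellFounded using (Acc; acc)
open import Relation.Nullary using (¬_; Dec; yes; no; does; contradiction)
open import Relation.Nullary.Decidable using (_×-dec_; decidable-stable)
open import Relation.Unary using (Decidable)
open import Relation.Binary using (DecidableEquality)
open import Relation.Binary.PropositionalEquality
  using (_≡_; _≢_; refl; sym; trans; cong; cong₂; subst; module ≡-Reasoning)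

private
  variable
    n : ℕ
    e f x c : E n
    A B B₀ C C₁ C₂ D S T W X : SubE n

∈─⁻ : ∀ {m} (p q : Subset m) {i} → i Sub.∈ (p Sub.─ q) → i Sub.∈ p × ¬ (i Sub.∈ q)
∈─⁻ (s ∷ p) (outside ∷ q) Vec.here = Vec.here , λ ()
∈─⁻ (s ∷ p) (t ∷ q) (Vec.there h) with ∈─⁻ p q h
... | i∈p , i∉q = Vec.there i∈p , λ { (Vec.there i∈q) → i∉q i∈q }

∈─⁺ : ∀ {m} (p q : Subset m) {i} → i Sub.∈ p → ¬ (i Sub.∈ q) → i Sub.∈ (p Sub.─ q)
∈─⁺ (s ∷ p) (inside ∷ q) Vec.here i∉q = contradiction Vec.here i∉q
∈─⁺ (s ∷ p) (outside ∷ q) Vec.here i∉q = Vec.here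
∈─⁺ (s ∷ p) (t ∷ q) (Vec.there h) i∉q = Vec.there (∈─⁺ p q h (i∉q ∘ Vec.there))

∪⁻ : ∀ (S T : SubE n) → e ∈ₑ (S ∪ₑ T) → e ∈ₑ S ⊎ e ∈ₑ T
∪⁻ {e = i , false} (P , Q) (P′ , Q′) h = x∈p∪q⁻ P P′ h
∪⁻ {e = i , true} (P , Q) (P′ , Q′) h = x∈p∪q⁻ Q Q′ h

∪⁺ : ∀ (S T : SubE n) → e ∈ₑ S ⊎ e ∈ₑ T → e ∈ₑ (S ∪ₑ T)
∪⁺ {e = i , false} (P , Q) (P′ , Q′) h = x∈p∪q⁺ h
∪⁺ {e = i , true} (P , Q) (P′ , Q′) h = x∈p∪q⁺ h

∩⁻ : ∀ (S T : SubE n) → e ∈ₑ (S ∩ₑ T) → e ∈ₑ S × e ∈ₑ T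
∩⁻ {e = i , false} (P , Q) (P′ , Q′) h = x∈p∩q⁻ P P′ h
∩⁻ {e = i , true} (P , Q) (P′ , Q′) h = x∈p∩q⁻ Q Q′ h

∩⁺ : ∀ (S T : SubE n) → e ∈ₑ S → e ∈ₑ T → e ∈ₑ (S ∩ₑ T)
∩⁺ {e = i , false} (P , Q) (P′ , Q′) e∈S e∈T = x∈p∩q⁺ (e∈S , e∈T)
∩⁺ {e = i , true} (P , Q) (P′ , Q′) e∈S e∈T = x∈p∩q⁺ (e∈S , e∈T)

─⁻ : ∀ (S T : SubE n) → e ∈ₑ (S ─ₑ T) → e ∈ₑ S × ¬ (e ∈ₑ T)
─⁻ {e = i , false} (P , Q) (P′ , Q′) h = ∈─⁻ P P′ h
─⁻ {e = i , true} (P , Q) (P′ , Q′) h = ∈─⁻ Q Q′ h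

─⁺ : ∀ (S T : SubE n) → e ∈ₑ S → ¬ (e ∈ₑ T) → e ∈ₑ (S ─ₑ T)
─⁺ {e = i , false} (P , Q) (P′ , Q′) e∈S e∉T = ∈─⁺ P P′ e∈S e∉T
─⁺ {e = i , true} (P , Q) (P′ , Q′) e∈S e∉T = ∈─⁺ Q Q′ e∈S e∉T

⁅⁆⁻ : ∀ (x : E n) → e ∈ₑ ⁅ x ⁆ₑ → e ≡ x
⁅⁆⁻ {e = i , false} (j , false) h = cong (_, false) (x∈⁅y⁆⇒x≡y j h)
⁅⁆⁻ {e = i , true} (j , false) h = contradiction h ∉⊥
⁅⁆⁻ {e = i , false} (j , true) h = contradiction h ∉⊥
⁅⁆⁻ {e = i , true} (j , true) h = cong (_, true) (x∈⁅y⁆⇒x≡y j h)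

⁅⁆⁺ : ∀ (x : E n) → x ∈ₑ ⁅ x ⁆ₑ
⁅⁆⁺ (i , false) = x∈⁅x⁆ i
⁅⁆⁺ (i , true) = x∈⁅x⁆ i

_∖_ : SubE n → E n → SubE n
S ∖ x = S ─ₑ ⁅ x ⁆ₑ

∖⁻ : ∀ (S : SubE n) (x : E n) → e ∈ₑ (S ∖ x) → e ∈ₑ S × e ≢ x
∖⁻ S x h = proj₁ (─⁻ S ⁅ x ⁆ₑ h) , λ { refl → proj₂ (─⁻ S ⁅ x ⁆ₑ h) (⁅⁆⁺ x) }

∖⁺ : ∀ (S : SubE n) (x : E n) → e ∈ₑ S → e ≢ x → e ∈ₑ (S ∖ x)
∖⁺ S x e∈S e≢x = ─⁺ S ⁅ x ⁆ₑ e∈S (e≢x ∘ ⁅⁆⁻ x)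

∖-⊆ : ∀ (S : SubE n) (x : E n) → (S ∖ x) ⊆ₑ S
∖-⊆ S x = proj₁ ∘ ∖⁻ S x

⊆ₑ-antisym : S ⊆ₑ T → T ⊆ₑ S → S ≡ T
⊆ₑ-antisym {S = P , Q} {T = P′ , Q′} S⊆T T⊆S =
  cong₂ _,_ (⊆-antisym (λ {i} → S⊆T {i , false}) (λ {i} → T⊆S {i , false}))
            (⊆-antisym (λ {i} → S⊆T {i , true}) (λ {i} → T⊆S {i , true}))

_⊆ₑ?_ : ∀ (S T : SubE n) → Dec (S ⊆ₑ T)
(P , Q) ⊆ₑ? (P′ , Q′) with P ⊆? P′ | Q ⊆? Q′
... | yes P⊆P′ | yes Q⊆Q′ = yes λ { {i , false} → P⊆P′ ; {i , true} → Q⊆Q′ }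
... | no P⊈P′ | _ = no λ S⊆T → P⊈P′ (λ {i} → S⊆T {i , false})
... | yes _ | no Q⊈Q′ = no λ S⊆T → Q⊈Q′ (λ {i} → S⊆T {i , true})

_≟ₑ_ : DecidableEquality (E n)
_≟ₑ_ = ≡-dec Fin._≟_ _≟ᵇ_

_≟ₛ_ : DecidableEquality (SubE n)
_≟ₛ_ = ≡-dec (VecP.≡-dec _≟ᵇ_) (VecP.≡-dec _≟ᵇ_)

∈-allE : ∀ (e : E n) → e ∈ allE n
∈-allE (i , b) = ∈-concatMap⁺ _ (Any.map (λ { refl → both b }) (∈-allFin i))
  where
  both : ∀ b → (i , b) ∈ ((i , false) ∷ (i , true) ∷ [])
  both false = here refl
  both true = there (here refl)

PairFree : SubE n → Set
PairFree S = ∀ {e} → e ∈ₑ S → ¬ ((e *) ∈ₑ S)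

admissible⇒pairFree : Admissible S → PairFree S
admissible⇒pairFree {S = P , Q} S∩S*≡∅ {i , false} e∈S e*∈S =
  ∉⊥ (subst (i Sub.∈_) (cong proj₁ S∩S*≡∅) (x∈p∩q⁺ (e∈S , e*∈S)))
admissible⇒pairFree {S = P , Q} S∩S*≡∅ {i , true} e∈S e*∈S =
  ∉⊥ (subst (i Sub.∈_) (cong proj₂ S∩S*≡∅) (x∈p∩q⁺ (e∈S , e*∈S)))

pairFree⇒admissible : PairFree S → Admissible S
pairFree⇒admissible {S = P , Q} free = cong₂ _,_
  (⊆-antisym (λ {i} h → ⊥-elim (uncurry (free {i , false}) (x∈p∩q⁻ P Q h))) (⊥-elim ∘ ∉⊥))
  (⊆-antisym (λ {i} h → ⊥-elim (uncurry (free {i , true}) (x∈p∩q⁻ Q P h))) (⊥-elim ∘ ∉⊥))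

admissible-⊆ : S ⊆ₑ T → Admissible T → Admissible S
admissible-⊆ S⊆T T-adm = pairFree⇒admissible λ e∈S e*∈S →
  admissible⇒pairFree T-adm (S⊆T e∈S) (S⊆T e*∈S)

cnt : ∀ {A : Set} {P : A → Set} → Decidable P → List A → ℕ
cnt P? [] = 0
cnt P? (a ∷ as) = if does (P? a) then suc (cnt P? as) else cnt P? as

module _ {A : Set} {P Q : A → Set} (P? : Decidable P) (Q? : Decidable Q) where

  cnt-mono : (∀ {a} → P a → Q a) → ∀ as → cnt P? as ≤ cnt Q? as
  cnt-mono P⊆Q [] = z≤n
  cnt-mono P⊆Q (a ∷ as) with P? a | Q? a
  ... | yes _ | yes _ = s≤s (cnt-mono P⊆Q as)
  ... | yes Pa | no ¬Qa = contradiction (P⊆Q Pa) ¬Qa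
  ... | no _ | yes _ = m≤n⇒m≤1+n (cnt-mono P⊆Q as)
  ... | no _ | no _ = cnt-mono P⊆Q as

  cnt-strict : (∀ {a} → P a → Q a) → ∀ {b as} → b ∈ as → Q b → ¬ P b → cnt P? as < cnt Q? as
  cnt-strict P⊆Q {as = a ∷ as} (here refl) Qb ¬Pb with P? a | Q? a
  ... | yes Pb | _ = contradiction Pb ¬Pb
  ... | no _ | yes _ = s≤s (cnt-mono P⊆Q as)
  ... | no _ | no ¬Qb = contradiction Qb ¬Qb
  cnt-strict P⊆Q {as = a ∷ as} (there b∈as) Qb ¬Pb with P? a | Q? a
  ... | yes _ | yes _ = s≤s (cnt-strict P⊆Q b∈as Qb ¬Pb)
  ... | yes Pa | no ¬Qa = contradiction (P⊆Q Pa) ¬Qa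
  ... | no _ | yes _ = m≤n⇒m≤1+n (cnt-strict P⊆Q b∈as Qb ¬Pb)
  ... | no _ | no _ = cnt-strict P⊆Q b∈as Qb ¬Pb

  cnt-filter : ∀ as → cnt Q? (filter P? as) ≡ cnt (λ a → P? a ×-dec Q? a) as
  cnt-filter [] = refl
  cnt-filter (a ∷ as) with P? a
  ... | no _ = cnt-filter as
  ... | yes _ with Q? a
  ...   | yes _ = cong suc (cnt-filter as)
  ...   | no _ = cnt-filter as

module _ {A : Set} {P : A → Set} (P? : Decidable P) where

  cnt-↭ : ∀ {as bs} → as ↭ bs → cnt P? as ≡ cnt P? bs
  cnt-↭ Perm.refl = refl
  cnt-↭ (prep a p) with P? a
  ... | yes _ = cong suc (cnt-↭ p)
  ... | no _ = cnt-↭ p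
  cnt-↭ (swap a b p) with P? a | P? b
  ... | yes _ | yes _ = cong (suc ∘ suc) (cnt-↭ p)
  ... | yes _ | no _ = cong suc (cnt-↭ p)
  ... | no _ | yes _ = cong suc (cnt-↭ p)
  ... | no _ | no _ = cnt-↭ p
  cnt-↭ (Perm.trans p q) = trans (cnt-↭ p) (cnt-↭ q)

  cnt-map : ∀ {B : Set} (g : B → A) bs → cnt P? (map g bs) ≡ cnt (P? ∘ g) bs
  cnt-map g [] = refl
  cnt-map g (b ∷ bs) with P? (g b)
  ... | yes _ = cong suc (cnt-map g bs)
  ... | no _ = cnt-map g bs

cnt-pointwise : ∀ {A : Set} {P : A → Set} {R : A → A → Set} (P? : Decidable P) →
                (∀ {a b} → R a b → P a → P b) →
                ∀ {as bs} → Pointwise R as bs → cnt P? as ≤ cnt P? bs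
cnt-pointwise P? P-resp [] = z≤n
cnt-pointwise P? P-resp {a ∷ _} {b ∷ _} (Rab ∷ p) with P? a | P? b
... | yes _ | yes _ = s≤s (cnt-pointwise P? P-resp p)
... | yes Pa | no ¬Pb = contradiction (P-resp Rab Pa) ¬Pb
... | no _ | yes _ = m≤n⇒m≤1+n (cnt-pointwise P? P-resp p)
... | no _ | no _ = cnt-pointwise P? P-resp p

count : {P : E n → Set} → Decidable P → ℕ
count {n} P? = cnt P? (allE n)

module _ {P Q : E n → Set} (P? : Decidable P) (Q? : Decidable Q) where

  count-mono : (∀ {e} → P e → Q e) → count P? ≤ count Q?
  count-mono P⊆Q = cnt-mono P? Q? P⊆Q (allE n)

  count-strict : (∀ {e} → P e → Q e) → Q e → ¬ P e → count P? < count Q?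
  count-strict P⊆Q = cnt-strict P? Q? P⊆Q (∈-allE _)

  count-cong : (∀ {e} → P e → Q e) → (∀ {e} → Q e → P e) → count P? ≡ count Q?
  count-cong P⊆Q Q⊆P = ≤-antisym (cnt-mono P? Q? P⊆Q (allE n)) (cnt-mono Q? P? Q⊆P (allE n))

# : SubE n → ℕ
# X = count (∈ₑ? X)

_∩?_ : ∀ (B X : SubE n) → Decidable (λ e → e ∈ₑ B × e ∈ₑ X)
(B ∩? X) e = ∈ₑ? B e ×-dec ∈ₑ? X e

∣_∩_∣ : SubE n → SubE n → ℕ
∣ B ∩ X ∣ = count (B ∩? X)

#≤∣∩∣ : X ⊆ₑ B → # X ≤ ∣ B ∩ X ∣
#≤∣∩∣ {X = X} {B = B} X⊆B = count-mono (∈ₑ? X) (B ∩? X) λ e∈X → X⊆B e∈X , e∈X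

∣∩∣-saturated⇒⊆ : # X ≤ ∣ B ∩ X ∣ → X ⊆ₑ B
∣∩∣-saturated⇒⊆ {X = X} {B = B} #X≤ {e} e∈X = decidable-stable (∈ₑ? B e) λ e∉B →
  <⇒≱ (count-strict (B ∩? X) (∈ₑ? X) proj₂ e∈X (e∉B ∘ proj₁)) #X≤

∣∩∣-∖ : ∀ (W : SubE n) → ¬ (e ∈ₑ B) → ∣ B ∩ W ∣ ≤ ∣ B ∩ (W ∖ e) ∣
∣∩∣-∖ {e = e} {B = B} W e∉B = count-mono (B ∩? W) (B ∩? (W ∖ e)) λ (f∈B , f∈W) →
  f∈B , ∖⁺ W e f∈W λ { refl → e∉B f∈B }

#-∖ : e ∈ₑ D → # (D ∖ e) < # D
#-∖ {e = e} {D = D} e∈D = count-strict (∈ₑ? (D ∖ e)) (∈ₑ? D) (∖-⊆ D e) e∈D λ e∈D∖e →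
  proj₂ (∖⁻ D e e∈D∖e) refl

sum-mono : ∀ {ms ns : List ℕ} → Pointwise _≤_ ms ns → sum ms ≤ sum ns
sum-mono [] = z≤n
sum-mono (m≤n ∷ p) = +-mono-≤ m≤n (sum-mono p)

sum-strict : ∀ {ms ns : List ℕ} → Pointwise _≤_ ms ns → ms ≢ ns → sum ms < sum ns
sum-strict [] []≢[] = contradiction refl []≢[]
sum-strict {m ∷ _} (m≤n ∷ p) ms≢ns with m≤n⇒m<n∨m≡n m≤n
... | inj₁ m<n = +-mono-<-≤ m<n (sum-mono p)
... | inj₂ refl = +-monoʳ-< m (sum-strict p (ms≢ns ∘ cong (m ∷_)))

sum-filter≤ : ∀ {A : Set} {P : A → Set} (g : A → ℕ) (P? : Decidable P) as →
              sum (map g (filter P? as)) ≤ sum (map g as)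
sum-filter≤ g P? [] = z≤n
sum-filter≤ g P? (a ∷ as) with does (P? a)
... | true = +-monoʳ-≤ (g a) (sum-filter≤ g P? as)
... | false = ≤-trans (sum-filter≤ g P? as) (m≤n+m _ (g a))

-- In a preorder with a strictly monotone measure bounded by N, an element
-- m that is the only maximal element of P is greater than every element of
-- P: starting from b ⋠ m one could climb forever through larger elements.

module UniqueMaximum
  {A : Set} (_≼_ : A → A → Set)
  (≼-refl : ∀ {a} → a ≼ a) (≼-trans : ∀ {a b c} → a ≼ b → b ≼ c → a ≼ c)
  (_≼?_ : ∀ a b → Dec (a ≼ b)) (_≟_ : DecidableEquality A)
  (μ : A → ℕ) (N : ℕ) (μ≤N : ∀ a → μ a ≤ N) (μ-strict : ∀ {a b} → a ≼ b → b ≢ a → μ a < μ b)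
  (P : A → Set) where

  Maximal : A → Set
  Maximal m = P m × (∀ b → P b → m ≼ b → b ≡ m)

  module _ (m : A) (unique : ∀ b → Maximal b → b ≡ m) where

    -- Induction on the room k left between μ b and the bound N.
    below : ∀ k b → P b → N ≤ μ b + k → b ≼ m
    above-below : ∀ k {b c} → N ≤ μ b + k → μ b < μ c → P c → c ≼ m

    below k b Pb N≤ = decidable-stable (b ≼? m) λ b⋠m →
      b⋠m (subst (b ≼_) (unique b (Pb , maximal b⋠m)) ≼-refl)
      where
      maximal : ¬ (b ≼ m) → ∀ c → P c → b ≼ c → c ≡ b
      maximal b⋠m c Pc b≼c = decidable-stable (c ≟ b) λ c≢b →
        b⋠m (≼-trans b≼c (above-below k N≤ (μ-strict b≼c c≢b) Pc))

    above-below zero {b} {c} N≤ μb<μc Pc =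
      contradiction (≤-trans (μ≤N c) (≤-trans N≤ (≤-reflexive (+-identityʳ (μ b))))) (<⇒≱ μb<μc)
    above-below (suc k) {b} {c} N≤ μb<μc Pc =
      below k c Pc (≤-trans N≤ (≤-trans (≤-reflexive (+-suc (μ b) k)) (+-monoˡ-≤ k μb<μc)))

    greatest : ∀ b → P b → b ≼ m
    greatest b Pb = below N b Pb (m≤n+m N (μ b))

IsUpperSet : LinOrd n → SubE n → ℕ → Set
IsUpperSet O X t = ∀ {e} → (e ∈ₑ X → t ≤ rank O e) × (t ≤ rank O e → e ∈ₑ X)

module GaleOrder (O : LinOrd n) where

  ranks : SubE n → List ℕ
  ranks A = map (rank O) (filter (∈ₑ? A) (allE n))

  ∈-ranks⁺ : e ∈ₑ A → rank O e ∈ ranks A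
  ∈-ranks⁺ e∈A = ∈-map⁺ (rank O) (∈-filter⁺ (∈ₑ? _) (∈-allE _) e∈A)

  ∈-ranks⁻ : ∀ A → rank O e ∈ ranks A → e ∈ₑ A
  ∈-ranks⁻ A h with ∈-map⁻ (rank O) h
  ... | e′ , e′∈ , same-rank with injective O same-rank
  ... | refl = proj₂ (∈-filter⁻ (∈ₑ? A) {xs = allE n} e′∈)

  sortedRanks-injective : ∀ A B → sortedRanks O A ≡ sortedRanks O B → A ≡ B
  sortedRanks-injective A B eq = ⊆ₑ-antisym
      (λ e∈A → ∈-ranks⁻ B (∈-resp-↭ A↭B (∈-ranks⁺ e∈A)))
      (λ e∈B → ∈-ranks⁻ A (∈-resp-↭ (↭-sym A↭B) (∈-ranks⁺ e∈B)))
    where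
    A↭B : ranks A ↭ ranks B
    A↭B = ↭-trans (↭-sym (sort-↭ (ranks A))) (subst (_↭ ranks B) (sym eq) (sort-↭ (ranks B)))

  weight : SubE n → ℕ
  weight A = sum (sortedRanks O A)

  weight-bound : ∀ A → weight A ≤ sum (map (rank O) (allE n))
  weight-bound A =
    ≤-trans (≤-reflexive (sum-↭ (sort-↭ (ranks A)))) (sum-filter≤ (rank O) (∈ₑ? A) (allE n))

  weight-strict : A ≤[ O ] B → B ≢ A → weight A < weight B
  weight-strict {A = A} {B = B} A≤B B≢A = sum-strict A≤B (B≢A ∘ sym ∘ sortedRanks-injective A B)

  gale-maximum : ∀ {𝓑 : SubE n → Set} → IsSymplecticMatroid n 𝓑 → AdmissibleOrd O →
                 Σ (SubE n) λ B₀ → 𝓑 B₀ × (∀ B → 𝓑 B → B ≤[ O ] B₀)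
  gale-maximum {𝓑} SM O-adm with IsSymplecticMatroid.uniqueMax SM O O-adm
  ... | B₀ , (B₀∈𝓑 , _) , unique = B₀ , B₀∈𝓑 , greatest B₀ unique
    where
    open UniqueMaximum (λ A B → A ≤[ O ] B) (Pointwise.refl ≤-refl) (Pointwise.transitive ≤-trans)
           (λ A B → Pointwise.decidable _≤?_ (sortedRanks O A) (sortedRanks O B)) _≟ₛ_
           weight _ weight-bound weight-strict 𝓑

  cnt-sortedRanks : ∀ t A →
    cnt (t ≤?_) (sortedRanks O A) ≡ count (λ e → ∈ₑ? A e ×-dec t ≤? rank O e)
  cnt-sortedRanks t A = trans (cnt-↭ (t ≤?_) (sort-↭ (ranks A)))
    (trans (cnt-map (t ≤?_) (rank O) (filter (∈ₑ? A) (allE n)))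
           (cnt-filter (∈ₑ? A) (λ e → t ≤? rank O e) (allE n)))

  upper-set-mono : ∀ {X t} → IsUpperSet O X t → A ≤[ O ] B → ∣ A ∩ X ∣ ≤ ∣ B ∩ X ∣
  upper-set-mono {A = A} {B = B} {X} {t} X-upper A≤B = begin
    ∣ A ∩ X ∣                                      ≡⟨ above A ⟩
    count (λ e → ∈ₑ? A e ×-dec t ≤? rank O e)   ≡⟨ cnt-sortedRanks t A ⟨
    cnt (t ≤?_) (sortedRanks O A)                 ≤⟨ cnt-pointwise (t ≤?_) (flip ≤-trans) A≤B ⟩
    cnt (t ≤?_) (sortedRanks O B)                 ≡⟨ cnt-sortedRanks t B ⟩
    count (λ e → ∈ₑ? B e ×-dec t ≤? rank O e)   ≡⟨ above B ⟨
    ∣ B ∩ X ∣                                      ∎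
    where
    open ≤-Reasoning
    above : ∀ A → ∣ A ∩ X ∣ ≡ count (λ e → ∈ₑ? A e ×-dec t ≤? rank O e)
    above A = count-cong (A ∩? X) (λ e → ∈ₑ? A e ×-dec t ≤? rank O e)
      (λ (e∈A , e∈X) → e∈A , proj₁ X-upper e∈X) (λ (e∈A , t≤) → e∈A , proj₂ X-upper t≤)

opposite-sum : ∀ (i : Fin n) → toℕ i + toℕ (opposite i) ≡ n ∸ 1
opposite-sum {suc m} i = trans (cong (toℕ i +_) (opposite-prop i)) (m+[n∸m]≡n (≤-pred (toℕ<n i)))

*-involutive : ∀ (e : E n) → (e *) * ≡ e
*-involutive (i , b) = cong (i ,_) (not-involutive b)

-- Equal sums reverse comparisons; with rank e + rank e* constant this makes
-- an ordering admissible.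
dual-flip : ∀ {a a′ b b′} → a + a′ ≡ b + b′ → a < b → b′ < a′
dual-flip eq a<b = ≰⇒> λ a′≤b′ → <-irrefl eq (+-mono-<-≤ a<b a′≤b′)

-- Ordering E_{±n} by a weight w with w e + w e* constant, ties broken by
-- the listing 1 < … < n < n* < … < 1*, gives an admissible ordering whose
-- upper sets at multiples of M are the sets {e : k ≤ w e}.

module WeightedOrder (w : E n → ℕ) (W : ℕ) (w-dual : ∀ e → w e + w (e *) ≡ W) where

  open +-*-Solver

  position : E n → ℕ
  position (i , false) = toℕ i
  position (i , true) = n + toℕ (opposite i)

  position-dual : ∀ e → position e + position (e *) ≡ n + (n ∸ 1)
  position-dual (i , false) = trans
    (solve 3 (λ a m b → a :+ (m :+ b) := m :+ (a :+ b)) refl (toℕ i) n (toℕ (opposite i)))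
    (cong (n +_) (opposite-sum i))
  position-dual (i , true) = trans (+-assoc n _ _)
    (cong (n +_) (trans (+-comm (toℕ (opposite i)) (toℕ i)) (opposite-sum i)))

  -- a bound on the positions, separating the weight classes
  M : ℕ
  M = suc (n + n)

  position<M : ∀ e → position e < M
  position<M (i , false) = s≤s (≤-trans (<⇒≤ (toℕ<n i)) (m≤m+n n n))
  position<M (i , true) = s≤s (+-monoʳ-≤ n (<⇒≤ (toℕ<n (opposite i))))

  position-injective : ∀ e f → position e ≡ position f → e ≡ f
  position-injective (i , false) (j , false) eq = cong (_, false) (toℕ-injective eq)
  position-injective (i , false) (j , true) eq = contradiction eq (<⇒≢ (<-≤-trans (toℕ<n i) (m≤m+n n _)))
  position-injective (i , true) (j , false) eq = contradiction (sym eq) (<⇒≢ (<-≤-trans (toℕ<n j) (m≤m+n n _)))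
  position-injective (i , true) (j , true) eq = cong (_, true) (begin
    i                       ≡⟨ opposite-involutive i ⟨
    opposite (opposite i)   ≡⟨ cong opposite (toℕ-injective (+-cancelˡ-≡ n _ _ eq)) ⟩
    opposite (opposite j)   ≡⟨ opposite-involutive j ⟩
    j                       ∎)
    where open ≡-Reasoning

  rankʷ : E n → ℕ
  rankʷ e = position e + w e * M

  rankʷ-dual : ∀ e → rankʷ e + rankʷ (e *) ≡ n + (n ∸ 1) + W * M
  rankʷ-dual e = trans
    (solve 5 (λ a x b y m → a :+ x :* m :+ (b :+ y :* m) := (a :+ b) :+ (x :+ y) :* m)
           refl (position e) (w e) (position (e *)) (w (e *)) M)
    (cong₂ (λ p v → p + v * M) (position-dual e) (w-dual e))

  -- the position is the remainder of the rank modulo M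
  rankʷ-injective : ∀ {e f} → rankʷ e ≡ rankʷ f → e ≡ f
  rankʷ-injective {e} {f} eq = position-injective e f (begin
    position e          ≡⟨ m<n⇒m%n≡m (position<M e) ⟨
    position e % M      ≡⟨ [m+kn]%n≡m%n (position e) (w e) M ⟨
    rankʷ e % M         ≡⟨ cong (_% M) eq ⟩
    rankʷ f % M         ≡⟨ [m+kn]%n≡m%n (position f) (w f) M ⟩
    position f % M      ≡⟨ m<n⇒m%n≡m (position<M f) ⟩
    position f          ∎)
    where open ≡-Reasoning

  order : LinOrd n
  order = record { rank = rankʷ ; injective = rankʷ-injective }

  order-admissible : AdmissibleOrd order
  order-admissible e f = dual-flip (trans (rankʷ-dual e) (sym (rankʷ-dual f)))

  threshold⁺ : ∀ k e → k ≤ w e → k * M ≤ rankʷ e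
  threshold⁺ k e k≤w = ≤-trans (*-monoˡ-≤ M k≤w) (m≤n+m _ (position e))

  threshold⁻ : ∀ k e → k * M ≤ rankʷ e → k ≤ w e
  threshold⁻ k e kM≤rank = ≮⇒≥ λ w<k → <⇒≱ (begin-strict
    rankʷ e                ≡⟨⟩
    position e + w e * M   <⟨ +-monoˡ-< (w e * M) (position<M e) ⟩
    suc (w e) * M          ≤⟨ *-monoˡ-≤ M w<k ⟩
    k * M                  ∎) kM≤rank
    where open ≤-Reasoning

χ : SubE n → E n → ℕ
χ X e = if does (∈ₑ? X e) then 1 else 0

χᶜ : SubE n → E n → ℕ
χᶜ X e = if does (∈ₑ? X e) then 0 else 1

χ-in : ∀ X (e : E n) → e ∈ₑ X → 1 ≤ χ X e
χ-in X e e∈X with ∈ₑ? X e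
... | yes _ = ≤-refl
... | no e∉X = contradiction e∈X e∉X

χ-out : ∀ X (e : E n) → ¬ (e ∈ₑ X) → χ X e ≤ 0
χ-out X e e∉X with ∈ₑ? X e
... | yes e∈X = contradiction e∈X e∉X
... | no _ = ≤-refl

χ≤1 : ∀ X (e : E n) → χ X e ≤ 1
χ≤1 X e with ∈ₑ? X e
... | yes _ = ≤-refl
... | no _ = z≤n

χᶜ-out : ∀ X (e : E n) → ¬ (e ∈ₑ X) → 1 ≤ χᶜ X e
χᶜ-out X e e∉X with ∈ₑ? X e
... | yes e∈X = contradiction e∈X e∉X
... | no _ = ≤-refl

χᶜ≤1 : ∀ X (e : E n) → χᶜ X e ≤ 1
χᶜ≤1 X e with ∈ₑ? X e
... | yes _ = z≤n
... | no _ = ≤-refl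

χ+χᶜ : ∀ X (e : E n) → χ X e + χᶜ X e ≡ 1
χ+χᶜ X e with ∈ₑ? X e
... | yes _ = refl
... | no _ = refl

-- For admissible S ⊇ I, the levels
--   4 on I,  3 on S - I,  2 off S ∪ S*,  1 on (S - I)*,  0 on I*
-- form a self-dual weight, so I and S are upper sets of an admissible order.

module Levels (I S : SubE n) (I⊆S : I ⊆ₑ S) (S-pairFree : PairFree S) where

  level : E n → ℕ
  level e = χ I e + χ S e + χᶜ I (e *) + χᶜ S (e *)

  level-dual : ∀ e → level e + level (e *) ≡ 4
  level-dual e = begin
    level e + level (e *)
      ≡⟨ cong (λ e** → level e + (χ I (e *) + χ S (e *) + χᶜ I e** + χᶜ S e**)) (*-involutive e) ⟩
    (χ I e + χ S e + χᶜ I (e *) + χᶜ S (e *)) + (χ I (e *) + χ S (e *) + χᶜ I e + χᶜ S e)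
      ≡⟨ solve 8 (λ a b c d a′ b′ c′ d′ → (a :+ b :+ c :+ d) :+ (a′ :+ b′ :+ c′ :+ d′)
                                     := (a :+ c′) :+ (b :+ d′) :+ ((a′ :+ c) :+ (b′ :+ d)))
               refl (χ I e) (χ S e) (χᶜ I (e *)) (χᶜ S (e *)) (χ I (e *)) (χ S (e *)) (χᶜ I e) (χᶜ S e) ⟩
    (χ I e + χᶜ I e) + (χ S e + χᶜ S e) + ((χ I (e *) + χᶜ I (e *)) + (χ S (e *) + χᶜ S (e *)))
      ≡⟨ cong₂ _+_ (cong₂ _+_ (χ+χᶜ I e) (χ+χᶜ S e)) (cong₂ _+_ (χ+χᶜ I (e *)) (χ+χᶜ S (e *))) ⟩
    4 ∎
    where
    open ≡-Reasoning
    open +-*-Solver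

  open WeightedOrder level 4 level-dual public

  four≤level : e ∈ₑ I → 4 ≤ level e
  four≤level {e} e∈I = +-mono-≤ (+-mono-≤ (+-mono-≤ (χ-in I e e∈I) (χ-in S e (I⊆S e∈I)))
    (χᶜ-out I (e *) (S-pairFree (I⊆S e∈I) ∘ I⊆S))) (χᶜ-out S (e *) (S-pairFree (I⊆S e∈I)))

  level≤three : ¬ (e ∈ₑ I) → level e ≤ 3
  level≤three {e} e∉I =
    +-mono-≤ (+-mono-≤ (+-mono-≤ (χ-out I e e∉I) (χ≤1 S e)) (χᶜ≤1 I (e *))) (χᶜ≤1 S (e *))

  three≤level : e ∈ₑ S → 3 ≤ level e
  three≤level {e} e∈S = +-mono-≤ (+-mono-≤ (+-mono-≤ {0} z≤n (χ-in S e e∈S))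
    (χᶜ-out I (e *) (S-pairFree e∈S ∘ I⊆S))) (χᶜ-out S (e *) (S-pairFree e∈S))

  level≤two : ¬ (e ∈ₑ S) → level e ≤ 2
  level≤two {e} e∉S =
    +-mono-≤ (+-mono-≤ (+-mono-≤ (χ-out I e (e∉S ∘ I⊆S)) (χ-out S e e∉S)) (χᶜ≤1 I (e *))) (χᶜ≤1 S (e *))

  I-upper : IsUpperSet order I (4 * M)
  I-upper {e} = threshold⁺ 4 e ∘ four≤level , λ 4M≤ →
    decidable-stable (∈ₑ? I e) λ e∉I → <⇒≱ (s≤s (level≤three e∉I)) (threshold⁻ 4 e 4M≤)

  S-upper : IsUpperSet order S (3 * M)
  S-upper {e} = threshold⁺ 3 e ∘ three≤level , λ 3M≤ →
    decidable-stable (∈ₑ? S e) λ e∉S → <⇒≱ (s≤s (level≤two e∉S)) (threshold⁻ 3 e 3M≤)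

module SymplecticMatroid {𝓑 : SubE n → Set} (SM : IsSymplecticMatroid n 𝓑) where

  Maximises : SubE n → SubE n → Set
  Maximises W B₀ = 𝓑 B₀ × (∀ B → 𝓑 B → ∣ B ∩ W ∣ ≤ ∣ B₀ ∩ W ∣)

  -- The greedy property: for admissible S ⊇ I some basis meets I and S
  -- maximally at the same time, namely the Gale-maximal basis of an
  -- admissible ordering in which I and S are upper sets.
  greedy : ∀ I S → Admissible S → I ⊆ₑ S → Σ (SubE n) λ B₀ → Maximises I B₀ × Maximises S B₀
  greedy I S S-adm I⊆S =
    let B₀ , B₀∈𝓑 , dominates = gale-maximum SM order-admissible
    in B₀ , (B₀∈𝓑 , λ B B∈𝓑 → upper-set-mono I-upper (dominates B B∈𝓑))
          , (B₀∈𝓑 , λ B B∈𝓑 → upper-set-mono S-upper (dominates B B∈𝓑))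
    where
    open Levels I S I⊆S (admissible⇒pairFree S-adm)
    open GaleOrder order

  maximiser : ∀ W → Admissible W → Σ (SubE n) (Maximises W)
  maximiser W W-adm = let B₀ , max , _ = greedy W W W-adm (λ e∈W → e∈W) in B₀ , max

  Independent : SubE n → Set
  Independent D = Σ (SubE n) λ B → 𝓑 B × D ⊆ₑ B

  independent⊆maximiser : Independent X → Maximises X B₀ → X ⊆ₑ B₀
  independent⊆maximiser (B , B∈𝓑 , X⊆B) (_ , maximal) =
    ∣∩∣-saturated⇒⊆ (≤-trans (#≤∣∩∣ X⊆B) (maximal B B∈𝓑))

  independent-or-dependent : ∀ D → Admissible D → Independent D ⊎ Dependent 𝓑 D
  independent-or-dependent D D-adm = decide (proj₂ (maximiser D D-adm))
    where
    decide : Maximises D B₀ → Independent D ⊎ Dependent 𝓑 D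
    decide {B₀} maximal with D ⊆ₑ? B₀
    ... | yes D⊆B₀ = inj₁ (B₀ , proj₁ maximal , D⊆B₀)
    ... | no D⊈B₀ = inj₂ (D-adm , λ B B∈𝓑 D⊆B → D⊈B₀ (independent⊆maximiser (B , B∈𝓑 , D⊆B) maximal))

  dependent? : ∀ D → Admissible D → Dec (Dependent 𝓑 D)
  dependent? D D-adm = from-sum (independent-or-dependent D D-adm)
    where
    from-sum : Independent D ⊎ Dependent 𝓑 D → Dec (Dependent 𝓑 D)
    from-sum (inj₁ (B , B∈𝓑 , D⊆B)) = no λ (_ , not-in-basis) → not-in-basis B B∈𝓑 D⊆B
    from-sum (inj₂ D-dep) = yes D-dep

  dependent-⊆ : ∀ {D′} → Dependent 𝓑 D′ → D′ ⊆ₑ D → Admissible D → Dependent 𝓑 D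
  dependent-⊆ (_ , not-in-basis) D′⊆D D-adm = D-adm , λ B B∈𝓑 D⊆B → not-in-basis B B∈𝓑 (D⊆B ∘ D′⊆D)

  circuit-∖-independent : IsCircuit 𝓑 C → e ∈ₑ C → Independent (C ∖ e)
  circuit-∖-independent {C = C} {e = e} ((C-adm , _) , minimal) e∈C =
    from-sum (independent-or-dependent (C ∖ e) (admissible-⊆ (∖-⊆ C e) C-adm))
    where
    -- were C ∖ e dependent, minimality of C would give C ∖ e = C ∋ e
    from-sum : Independent (C ∖ e) ⊎ Dependent 𝓑 (C ∖ e) → Independent (C ∖ e)
    from-sum (inj₁ C∖e-indep) = C∖e-indep
    from-sum (inj₂ C∖e-dep) =
      contradiction refl (proj₂ (∖⁻ C e (subst (e ∈ₑ_) (sym (minimal (C ∖ e) C∖e-dep (∖-⊆ C e))) e∈C)))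

  -- Every dependent set contains a circuit: delete points while the set
  -- stays dependent; a set admitting no such deletion is a circuit.
  circuit-within : Dependent 𝓑 D → Σ (SubE n) λ C → IsCircuit 𝓑 C × C ⊆ₑ D
  circuit-within {D = D} D-dep = shrink D D-dep (<-wellFounded (# D))
    where
    Removable : SubE n → E n → Set
    Removable D e = e ∈ₑ D × Dependent 𝓑 (D ∖ e)

    removable? : ∀ D → Admissible D → Decidable (Removable D)
    removable? D D-adm e = ∈ₑ? D e ×-dec dependent? (D ∖ e) (admissible-⊆ (∖-⊆ D e) D-adm)

    shrink : ∀ D → Dependent 𝓑 D → Acc _<_ (# D) → Σ (SubE n) λ C → IsCircuit 𝓑 C × C ⊆ₑ D
    shrink D D-dep (acc smaller) = step (any? (removable? D (proj₁ D-dep)) (allE n))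
      where
      step : Dec (Any.Any (Removable D) (allE n)) → Σ (SubE n) λ C → IsCircuit 𝓑 C × C ⊆ₑ D
      step (yes found) =
        let e , e∈D , D∖e-dep = Any.satisfied found
            C , C-circ , C⊆D∖e = shrink (D ∖ e) D∖e-dep (smaller (#-∖ e∈D))
        in C , C-circ , ∖-⊆ D e ∘ C⊆D∖e
      step (no none) = D , (D-dep , minimal) , λ e∈D → e∈D
        where
        removable-if-missing : ∀ {D′ e} → Dependent 𝓑 D′ → D′ ⊆ₑ D → e ∈ₑ D → ¬ (e ∈ₑ D′) → Removable D e
        removable-if-missing {e = e} D′-dep D′⊆D e∈D e∉D′ =
          e∈D , dependent-⊆ D′-dep (λ f∈D′ → ∖⁺ D e (D′⊆D f∈D′) λ { refl → e∉D′ f∈D′ })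
                  (admissible-⊆ (∖-⊆ D e) (proj₁ D-dep))

        minimal : ∀ D′ → Dependent 𝓑 D′ → D′ ⊆ₑ D → D′ ≡ D
        minimal D′ D′-dep D′⊆D = ⊆ₑ-antisym D′⊆D λ {e} e∈D → decidable-stable (∈ₑ? D′ e) λ e∉D′ →
          none (Any.map (λ { refl → removable-if-missing D′-dep D′⊆D e∈D e∉D′ }) (∈-allE e))

  circuit-point-redundant : Admissible W → IsCircuit 𝓑 C → C ⊆ₑ W → e ∈ₑ C →
    ∀ B → 𝓑 B → Σ (SubE n) λ B′ → 𝓑 B′ × ∣ B ∩ W ∣ ≤ ∣ B′ ∩ (W ∖ e) ∣
  circuit-point-redundant {W = W} {C = C} {e = e} W-adm C-circ C⊆W e∈C B B∈𝓑 =
    let B′ , maximal-C∖e , (B′∈𝓑 , maximal-W) = greedy (C ∖ e) W W-adm (C⊆W ∘ ∖-⊆ C e)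
    in B′ , B′∈𝓑 , ≤-trans (maximal-W B B∈𝓑) (∣∩∣-∖ W (e∉ maximal-C∖e B′∈𝓑))
    where
    e∉ : ∀ {B′} → Maximises (C ∖ e) B′ → 𝓑 B′ → ¬ (e ∈ₑ B′)
    e∉ {B′} maximal-C∖e B′∈𝓑 e∈B′ = proj₂ (proj₁ C-circ) B′ B′∈𝓑 C⊆B′
      where
      C∖e⊆B′ : (C ∖ e) ⊆ₑ B′
      C∖e⊆B′ = independent⊆maximiser (circuit-∖-independent C-circ e∈C) maximal-C∖e

      C⊆B′ : C ⊆ₑ B′
      C⊆B′ {f} f∈C with f ≟ₑ e
      ... | yes refl = e∈B′
      ... | no f≢e = C∖e⊆B′ (∖⁺ C e f∈C f≢e)

  -- With Bᵣ a basis meeting Rest = T - {c, x} maximally, the set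
  -- J = (Bᵣ ∩ Rest) ∪ {c} is dependent: a basis containing it would meet T
  -- in more points than Bᵣ meets Rest, although deleting c ∈ C₁ and then
  -- x ∈ C₂ never lowers this number.  A circuit inside J must contain c,
  -- since J - {c} ⊆ Bᵣ.
  strong-elimination : ∀ T → Admissible T → IsCircuit 𝓑 C₁ → IsCircuit 𝓑 C₂ → C₁ ⊆ₑ T → C₂ ⊆ₑ T →
    x ∈ₑ C₂ → c ∈ₑ C₁ → ¬ (c ∈ₑ C₂) → Σ (SubE n) λ C → IsCircuit 𝓑 C × c ∈ₑ C × C ⊆ₑ (T ∖ x)
  strong-elimination {C₁ = C₁} {C₂ = C₂} {x = x} {c = c} T T-adm C₁-circ C₂-circ C₁⊆T C₂⊆T x∈C₂ c∈C₁ c∉C₂ =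
    let Bᵣ , maximal-Rest = maximiser Rest (admissible-⊆ (proj₁ ∘ Rest⁻) T-adm)
        C , C-circ , C⊆J = circuit-within (J-dependent maximal-Rest)
    in C , C-circ , c∈circuit (proj₁ maximal-Rest) C-circ C⊆J , J⊆T∖x ∘ C⊆J
    where
    Rest : SubE n
    Rest = (T ∖ c) ∖ x

    J : SubE n → SubE n
    J Bᵣ = (Bᵣ ∩ₑ Rest) ∪ₑ ⁅ c ⁆ₑ

    Rest⁻ : f ∈ₑ Rest → f ∈ₑ T × f ≢ c × f ≢ x
    Rest⁻ f∈Rest = let f∈T∖c , f≢x = ∖⁻ (T ∖ c) x f∈Rest
                       f∈T , f≢c = ∖⁻ T c f∈T∖c
                   in f∈T , f≢c , f≢x

    J⁻ : ∀ Bᵣ → f ∈ₑ J Bᵣ → (f ∈ₑ Bᵣ × f ∈ₑ Rest) ⊎ f ≡ c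
    J⁻ Bᵣ f∈J with ∪⁻ (Bᵣ ∩ₑ Rest) ⁅ c ⁆ₑ f∈J
    ... | inj₁ f∈Bᵣ∩Rest = inj₁ (∩⁻ Bᵣ Rest f∈Bᵣ∩Rest)
    ... | inj₂ f∈⁅c⁆ = inj₂ (⁅⁆⁻ c f∈⁅c⁆)

    J⊆T∖x : ∀ {Bᵣ} → J Bᵣ ⊆ₑ (T ∖ x)
    J⊆T∖x {Bᵣ} f∈J with J⁻ Bᵣ f∈J
    ... | inj₁ (_ , f∈Rest) = let f∈T , _ , f≢x = Rest⁻ f∈Rest in ∖⁺ T x f∈T f≢x
    ... | inj₂ refl = ∖⁺ T x (C₁⊆T c∈C₁) λ { refl → c∉C₂ x∈C₂ }

    bound : ∀ {Bᵣ} → Maximises Rest Bᵣ → ∀ B → 𝓑 B → ∣ B ∩ T ∣ ≤ ∣ Bᵣ ∩ Rest ∣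
    bound (_ , maximal) B B∈𝓑 =
      let B′ , B′∈𝓑 , T≤T∖c = circuit-point-redundant T-adm C₁-circ C₁⊆T c∈C₁ B B∈𝓑
          B″ , B″∈𝓑 , T∖c≤Rest = circuit-point-redundant (admissible-⊆ (∖-⊆ T c) T-adm) C₂-circ
                                   (λ f∈C₂ → ∖⁺ T c (C₂⊆T f∈C₂) λ { refl → c∉C₂ f∈C₂ }) x∈C₂ B′ B′∈𝓑
      in ≤-trans T≤T∖c (≤-trans T∖c≤Rest (maximal B″ B″∈𝓑))

    J-in-basis : ∀ {Bᵣ} → J Bᵣ ⊆ₑ B → ∣ Bᵣ ∩ Rest ∣ < ∣ B ∩ T ∣
    J-in-basis {B = B} {Bᵣ} J⊆B = count-strict (Bᵣ ∩? Rest) (B ∩? T)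
      (λ (f∈Bᵣ , f∈Rest) → J⊆B (∪⁺ _ ⁅ c ⁆ₑ (inj₁ (∩⁺ Bᵣ Rest f∈Bᵣ f∈Rest))) , proj₁ (Rest⁻ f∈Rest))
      (J⊆B (∪⁺ (Bᵣ ∩ₑ Rest) _ (inj₂ (⁅⁆⁺ c))) , C₁⊆T c∈C₁)
      (λ (_ , c∈Rest) → proj₁ (proj₂ (Rest⁻ c∈Rest)) refl)

    J-dependent : ∀ {Bᵣ} → Maximises Rest Bᵣ → Dependent 𝓑 (J Bᵣ)
    J-dependent maximal = admissible-⊆ (∖-⊆ T x ∘ J⊆T∖x) T-adm , λ B B∈𝓑 J⊆B →
      <⇒≱ (J-in-basis J⊆B) (bound maximal B B∈𝓑)

    -- J Bᵣ - {c} ⊆ Bᵣ, so a circuit inside J Bᵣ must contain c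
    c∈circuit : ∀ {Bᵣ} → 𝓑 Bᵣ → IsCircuit 𝓑 C → C ⊆ₑ J Bᵣ → c ∈ₑ C
    c∈circuit {C = C} {Bᵣ} Bᵣ∈𝓑 C-circ C⊆J = decidable-stable (∈ₑ? C c) λ c∉C →
      proj₂ (proj₁ C-circ) Bᵣ Bᵣ∈𝓑 λ f∈C → in-Bᵣ f∈C c∉C (J⁻ Bᵣ (C⊆J f∈C))
      where
      in-Bᵣ : f ∈ₑ C → ¬ (c ∈ₑ C) → (f ∈ₑ Bᵣ × f ∈ₑ Rest) ⊎ f ≡ c → f ∈ₑ Bᵣ
      in-Bᵣ _ _ (inj₁ (f∈Bᵣ , _)) = f∈Bᵣ
      in-Bᵣ f∈C c∉C (inj₂ refl) = contradiction f∈C c∉C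

-- The theorem.  Whichever circuit contains c plays C₁.

lemma2 : (n : ℕ) (𝓑 : SubE n → Set) → IsSymplecticMatroid n 𝓑 →
         (C₁ C₂ : SubE n) → IsCircuit 𝓑 C₁ → IsCircuit 𝓑 C₂ → C₁ ≢ C₂ →
         Admissible (C₁ ∪ₑ C₂) →
         (x : E n) → x ∈ₑ (C₁ ∩ₑ C₂) →
         (c : E n) → c ∈ₑ (C₁ Δₑ C₂) →
         Σ (SubE n) (λ C → IsCircuit 𝓑 C × c ∈ₑ C × C ⊆ₑ ((C₁ ∪ₑ C₂) ─ₑ ⁅ x ⁆ₑ))
lemma2 n 𝓑 SM C₁ C₂ C₁-circ C₂-circ _ T-adm x x∈C₁∩C₂ c c∈C₁ΔC₂ =
  let x∈C₁ , x∈C₂ = ∩⁻ C₁ C₂ x∈C₁∩C₂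
      c∈C₁∪C₂ , c∉C₁∩C₂ = ─⁻ (C₁ ∪ₑ C₂) (C₁ ∩ₑ C₂) c∈C₁ΔC₂
  in [ (λ c∈C₁ → strong-elimination (C₁ ∪ₑ C₂) T-adm C₁-circ C₂-circ C₁⊆C₁∪C₂ C₂⊆C₁∪C₂
                   x∈C₂ c∈C₁ (λ c∈C₂ → c∉C₁∩C₂ (∩⁺ C₁ C₂ c∈C₁ c∈C₂)))
     , (λ c∈C₂ → strong-elimination (C₁ ∪ₑ C₂) T-adm C₂-circ C₁-circ C₂⊆C₁∪C₂ C₁⊆C₁∪C₂
                   x∈C₁ c∈C₂ (λ c∈C₁ → c∉C₁∩C₂ (∩⁺ C₁ C₂ c∈C₁ c∈C₂)))
     ]′ (∪⁻ C₁ C₂ c∈C₁∪C₂)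
  where
  open SymplecticMatroid SM

  C₁⊆C₁∪C₂ : C₁ ⊆ₑ (C₁ ∪ₑ C₂)
  C₁⊆C₁∪C₂ e∈C₁ = ∪⁺ C₁ C₂ (inj₁ e∈C₁)

  C₂⊆C₁∪C₂ : C₂ ⊆ₑ (C₁ ∪ₑ C₂)
  C₂⊆C₁∪C₂ e∈C₂ = ∪⁺ C₁ C₂ (inj₂ e∈C₂)
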